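{- Let $f\colon\mathbb{N}\to\mathbb{C}$ (with $\mathbb{N}=\{0,1,2,\ldots\}$). Define for $n\in\mathbb{N}$: $S_f(n)=\sum_{k=0}^{n-1} f(k)$, $T_0(n)=\sum_{k=0}^{n-1} f(2k)$, $T_1(n)=\sum_{k=0}^{n-1} f(2k+1)$. Let $T_0^+\colon\{\tfrac{0}{2},\tfrac12,\tfrac22,\tfrac32,\ldots\}\to\mathbb{C}$ be any function with $T_0^+(n)=T_0(n)$ for all $n\in\mathbb{N}$. Then the following are equivalent: (i) $T_0^+(\frac{n}{2})+T_0^+(\frac{n+1}{2})-S_f(n)$ is constant on $\mathbb{N}$; (ii) $T_0^+(\frac{n}{2}+1)-T_0^+(\frac{n}{2})=f(n)$ for all odd $n\in\mathbb{N}$; (iii) $T_0^+(n+\frac12)-T_1(n)$ is constant on $\mathbb{N}$.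
   Context: Empty sums are $0$. -}

module Defs where

open import Level using (Level)
open import Data.Nat using (ℕ; zero; suc; _*_)
open import Data.Product using (∃)
open import Relation.Binary.PropositionalEquality using (_≡_)
open import Algebra.Bundles using (AbelianGroup)

Odd : ℕ → Set
Odd n = ∃ λ k → n ≡ suc (2 * k)

module _ {c ℓ : Level} (G : AbelianGroup c ℓ) where
  open AbelianGroup G

  sumBelow : (ℕ → Carrier) → ℕ → Carrier
  sumBelow f zero    = ε
  sumBelow f (suc n) = sumBelow f n ∙ f n

  S : (ℕ → Carrier) → ℕ → Carrier
  S f n = sumBelow f n

  T₀ : (ℕ → Carrier) → ℕ → Carrier
  T₀ f n = sumBelow (λ k → f (2 * k)) n

  T₁ : (ℕ → Carrier) → ℕ → Carrier
  T₁ f n = sumBelow (λ k → f (suc (2 * k))) n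

  IsConstant : (ℕ → Carrier) → Set (c Level.⊔ ℓ)
  IsConstant g = ∃ λ a → ∀ n → g n ≈ a

-- Let D n = T n + T (n+1) − S f n and E k = T (2k+1) − T₁ f k.  Both are
-- constant iff their successive differences vanish, and these differences
-- are, up to rearrangement, T (n+2) − T n − f n (for every n in the case of
-- D, for odd n in the case of E).  For even n that last quantity vanishes
-- anyway, because T agrees with T₀ f on even arguments; so all three
-- conditions say that T (n+2) − T n = f n for every odd n.
module Submission where

open import Defs
open import Level using (Level)
open import Data.Nat using (ℕ; zero; suc; _+_; _*_)
open import Data.Nat.Properties using (*-suc; +-comm)
open import Data.Product using (_×_; _,_; ∃)
open import Data.Sum using (_⊎_; inj₁; inj₂)
open import Function.Bundles using (_⇔_; mk⇔; Equivalence)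
open import Function.Construct.Composition using (_⇔-∘_)
open import Function.Construct.Symmetry using (⇔-sym)
open import Algebra.Bundles using (AbelianGroup)
open import Relation.Binary.PropositionalEquality as ≡ using (_≡_)
import Algebra.Properties.AbelianGroup as AbelianGroupProperties
import Relation.Binary.Reasoning.Setoid as SetoidReasoning

open Equivalence using (to; from)

even⊎odd : ∀ n → (∃ λ k → n ≡ 2 * k) ⊎ Odd n
even⊎odd zero = inj₁ (0 , ≡.refl)
even⊎odd (suc n) with even⊎odd n
... | inj₁ (k , n≡2k)  = inj₂ (k , ≡.cong suc n≡2k)
... | inj₂ (k , n≡2k+1) = inj₁ (suc k , ≡.trans (≡.cong suc n≡2k+1) (≡.sym (*-suc 2 k)))

2*suc≡2*+2 : ∀ k → 2 * suc k ≡ 2 * k + 2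
2*suc≡2*+2 k = ≡.trans (*-suc 2 k) (+-comm 2 (2 * k))

module _ {p} (P : ℕ → Set p) where

  ∀-odd⇔∀-suc-double : (∀ n → Odd n → P n) ⇔ (∀ k → P (suc (2 * k)))
  ∀-odd⇔∀-suc-double = mk⇔ (λ h k → h (suc (2 * k)) (k , ≡.refl))
                             (λ { h n (k , ≡.refl) → h k })

  even∧odd⇒∀ : (∀ k → P (2 * k)) → (∀ n → Odd n → P n) → ∀ n → P n
  even∧odd⇒∀ even odd n with even⊎odd n
  ... | inj₁ (k , ≡.refl) = even k
  ... | inj₂ n-odd        = odd n n-odd

∀-cong-⇔ : ∀ {a p q} {A : Set a} {P : A → Set p} {Q : A → Set q} →
           (∀ x → P x ⇔ Q x) → (∀ x → P x) ⇔ (∀ x → Q x)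
∀-cong-⇔ P⇔Q = mk⇔ (λ h x → to (P⇔Q x) (h x)) (λ h x → from (P⇔Q x) (h x))

module _ {c ℓ : Level} (G : AbelianGroup c ℓ) where
  open AbelianGroup G
  open AbelianGroupProperties G
  open SetoidReasoning setoid

  ≈-respˡ-⇔ : ∀ {x y z} → x ≈ y → (x ≈ z) ⇔ (y ≈ z)
  ≈-respˡ-⇔ x≈y = mk⇔ (trans (sym x≈y)) (trans x≈y)

  x-y≈z⇒x-z≈y : ∀ x y z → x - y ≈ z → x - z ≈ y
  x-y≈z⇒x-z≈y x y z x-y≈z = sym (x≈z//y y z x (begin
    y ∙ z        ≈⟨ comm y z ⟩
    z ∙ y        ≈⟨ ∙-congʳ x-y≈z ⟨
    (x - y) ∙ y  ≈⟨ //-rightDividesˡ y x ⟩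
    x            ∎))

  x-y≈z⇔x-z≈y : ∀ x y z → (x - y ≈ z) ⇔ (x - z ≈ y)
  x-y≈z⇔x-z≈y x y z = mk⇔ (x-y≈z⇒x-z≈y x y z) (x-y≈z⇒x-z≈y x z y)

  x-[y∙z]≈x-z-y : ∀ x y z → x - (y ∙ z) ≈ (x - z) - y
  x-[y∙z]≈x-z-y x y z = begin
    x ∙ (y ∙ z) ⁻¹     ≈⟨ ∙-congˡ (⁻¹-anti-homo-∙ y z) ⟩
    x ∙ (z ⁻¹ ∙ y ⁻¹)  ≈⟨ assoc x (z ⁻¹) (y ⁻¹) ⟨
    (x - z) - y        ∎

  x∙y-[z∙x]≈y-z : ∀ x y z → (x ∙ y) - (z ∙ x) ≈ y - z
  x∙y-[z∙x]≈y-z x y z = begin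
    (x ∙ y) - (z ∙ x)  ≈⟨ ∙-congʳ (comm x y) ⟩
    (y ∙ x) - (z ∙ x)  ≈⟨ x-[y∙z]≈x-z-y (y ∙ x) z x ⟩
    ((y ∙ x) - x) - z  ≈⟨ ∙-congʳ (//-rightDividesʳ x y) ⟩
    y - z              ∎

  difference-step-⇔ : ∀ a a′ b y → (a′ - (b ∙ y) ≈ a - b) ⇔ (a′ - a ≈ y)
  difference-step-⇔ a a′ b y =
    x-y≈z⇔x-z≈y a′ y a
    ⇔-∘ (mk⇔ (∙-cancelʳ (b ⁻¹) (a′ - y) a) ∙-congʳ
    ⇔-∘ ≈-respˡ-⇔ (x-[y∙z]≈x-z-y a′ b y))

  isConstant⇔stationary : (g : ℕ → Carrier) → IsConstant G g ⇔ (∀ n → g (suc n) ≈ g n)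
  isConstant⇔stationary g = mk⇔ (λ (a , g≈a) n → trans (g≈a (suc n)) (sym (g≈a n)))
                                (λ stat → g 0 , ≈g0 stat)
    where
    ≈g0 : (∀ n → g (suc n) ≈ g n) → ∀ n → g n ≈ g 0
    ≈g0 stat zero    = refl
    ≈g0 stat (suc n) = trans (stat n) (≈g0 stat n)

  module _ (f T : ℕ → Carrier) where

    TwoStepIncrement : ℕ → Set ℓ
    TwoStepIncrement n = T (n + 2) - T n ≈ f n

    T-cong : ∀ {m n} → m ≡ n → T m ≈ T n
    T-cong m≡n = reflexive (≡.cong T m≡n)

    pairSum-stationary⇔ : ∀ n →
      ((T (suc n) ∙ T (suc (suc n))) - S G f (suc n) ≈ (T n ∙ T (suc n)) - S G f n)
      ⇔ TwoStepIncrement n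
    pairSum-stationary⇔ n =
      ≈-respˡ-⇔ (trans (x∙y-[z∙x]≈y-z (T (suc n)) (T (suc (suc n))) (T n))
                       (∙-congʳ (T-cong (+-comm 2 n))))
      ⇔-∘ difference-step-⇔ (T n ∙ T (suc n)) (T (suc n) ∙ T (suc (suc n))) (S G f n) (f n)

    oddPart-stationary⇔ : ∀ k →
      (T (suc (2 * suc k)) - T₁ G f (suc k) ≈ T (suc (2 * k)) - T₁ G f k)
      ⇔ TwoStepIncrement (suc (2 * k))
    oddPart-stationary⇔ k =
      ≈-respˡ-⇔ (∙-congʳ (T-cong (≡.cong suc (2*suc≡2*+2 k))))
      ⇔-∘ difference-step-⇔ (T (suc (2 * k))) (T (suc (2 * suc k))) (T₁ G f k) (f (suc (2 * k)))

    even-increments : (∀ n → T (2 * n) ≈ T₀ G f n) → ∀ k → TwoStepIncrement (2 * k)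
    even-increments T≈T₀ k = begin
      T (2 * k + 2) - T (2 * k)         ≈⟨ ∙-congʳ (T-cong (≡.sym (2*suc≡2*+2 k))) ⟩
      T (2 * suc k) - T (2 * k)         ≈⟨ ∙-cong (T≈T₀ (suc k)) (⁻¹-cong (T≈T₀ k)) ⟩
      (T₀ G f k ∙ f (2 * k)) - T₀ G f k ≈⟨ xyx⁻¹≈y (T₀ G f k) (f (2 * k)) ⟩
      f (2 * k)                         ∎

    pairSum-constant⇔odd-increments : (∀ n → T (2 * n) ≈ T₀ G f n) →
      IsConstant G (λ n → (T n ∙ T (suc n)) - S G f n) ⇔ (∀ n → Odd n → TwoStepIncrement n)
    pairSum-constant⇔odd-increments T≈T₀ =
      mk⇔ (λ h n _ → h n) (even∧odd⇒∀ TwoStepIncrement (even-increments T≈T₀))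
      ⇔-∘ (∀-cong-⇔ pairSum-stationary⇔
      ⇔-∘ isConstant⇔stationary _)

    odd-increments⇔oddPart-constant :
      (∀ n → Odd n → TwoStepIncrement n) ⇔ IsConstant G (λ n → T (suc (2 * n)) - T₁ G f n)
    odd-increments⇔oddPart-constant =
      ⇔-sym (isConstant⇔stationary _)
      ⇔-∘ (⇔-sym (∀-cong-⇔ oddPart-stationary⇔)
      ⇔-∘ ∀-odd⇔∀-suc-double TwoStepIncrement)

proposition3p6 : ∀ {c ℓ : Level} (G : AbelianGroup c ℓ) →
    let open AbelianGroup G in
    (f : ℕ → Carrier) (T : ℕ → Carrier) →
    (∀ n → T (2 * n) ≈ T₀ G f n) →
    ((IsConstant G (λ n → (T n ∙ T (suc n)) - S G f n))
    ⇔ (∀ n → Odd n → T (n + 2) - T n ≈ f n))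
    × ((∀ n → Odd n → T (n + 2) - T n ≈ f n)
    ⇔ IsConstant G (λ n → T (suc (2 * n)) - T₁ G f n))
proposition3p6 G f T T≈T₀ =
  pairSum-constant⇔odd-increments G f T T≈T₀ , odd-increments⇔oddPart-constant G f T
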